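{- Let $\mathcal{F}=\{F_1,\dots,F_k\}$ be a set of $k$ mutually orthogonal binary frequency squares of type $(n;\lambda_0,\lambda_1)$ with $\mathbb{Z}$-sum $M=F_1+\cdots+F_k$. Then there exists a set $\mathcal{F}'=\{F_1',\dots,F_k'\}$ of $k$ mutually orthogonal binary frequency squares of type $(n+k\lambda_1;\,n+(k-1)\lambda_1,\,\lambda_1)$ whose $\mathbb{Z}$-sum is the block matrix $$\begin{bmatrix} M & 0\\ 0 & J_{k\lambda_1}\end{bmatrix},$$ where $J_{m}$ denotes the $m\times m$ all-ones matrix and $0$ denotes zero blocks of the appropriate sizes.
   Context: A binary frequency square of type $(n;\lambda_0,\lambda_1)$, $\lambda_0+\lambda_1=n$, is an $n\times n$ $(0,1)$-matrix with exactly $\lambda_0$ zeros and $\lambda_1$ ones in each row and column; two binary squares of the same type $(n;\lambda_0,\lambda_1)$ are orthogonal if exactly $\lambda_1^2$ cells contain $1$ in both; mutually orthogonal means pairwise orthogonal. The $\mathbb{Z}$-sum of a set of squares is their entrywise integer sum. -}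

module Defs where

open import Data.Nat using (ℕ; zero; suc; _+_; _*_)
open import Data.Fin using (Fin; zero; suc; splitAt)
open import Data.Sum using (_⊎_; inj₁; inj₂)
open import Data.Product using (_×_; ∃₂)
open import Relation.Binary.PropositionalEquality using (_≡_; _≢_)

Matrix : ℕ → Set
Matrix n = Fin n → Fin n → ℕ

countOnes : ∀ {m} → (Fin m → ℕ) → ℕ
countOnes {zero}  f = 0
countOnes {suc m} f with f zero
... | 1 = suc (countOnes (λ i → f (suc i)))
... | _ = countOnes (λ i → f (suc i))

countZeros : ∀ {m} → (Fin m → ℕ) → ℕ
countZeros {zero}  f = 0
countZeros {suc m} f with f zero
... | 0 = suc (countZeros (λ i → f (suc i)))
... | _ = countZeros (λ i → f (suc i))

record IsBFS (n λ₀ λ₁ : ℕ) (F : Matrix n) : Set where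
  field
    type-sum  : λ₀ + λ₁ ≡ n
    binary    : ∀ i j → (F i j ≡ 0) ⊎ (F i j ≡ 1)
    row-zeros : ∀ i → countZeros (λ j → F i j) ≡ λ₀
    row-ones  : ∀ i → countOnes  (λ j → F i j) ≡ λ₁
    col-zeros : ∀ j → countZeros (λ i → F i j) ≡ λ₀
    col-ones  : ∀ j → countOnes  (λ i → F i j) ≡ λ₁

sumFin : ∀ {m} → (Fin m → ℕ) → ℕ
sumFin {zero}  f = 0
sumFin {suc m} f = f zero + sumFin (λ i → f (suc i))

bothOnes : ∀ {n} → Matrix n → Matrix n → ℕ
bothOnes {n} F G = sumFin {n} (λ i → countOnes {n} (λ j → F i j * G i j))

Orthogonal : ∀ {n} (λ₁ : ℕ) → Matrix n → Matrix n → Set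
Orthogonal λ₁ F G = bothOnes F G ≡ λ₁ * λ₁

record IsMOFS (k n λ₀ λ₁ : ℕ) (F : Fin k → Matrix n) : Set where
  field
    isBFS    : ∀ a → IsBFS n λ₀ λ₁ (F a)
    distinct : ∀ a b → a ≢ b → ∃₂ λ i j → F a i j ≢ F b i j
    orth     : ∀ a b → a ≢ b → Orthogonal λ₁ (F a) (F b)

-- ℤ-sum (entrywise integer sum; entries here are nonnegative so ℕ suffices)
ZSum : ∀ {k n} → (Fin k → Matrix n) → Matrix n
ZSum F i j = sumFin (λ a → F a i j)

blockDiagJ : ∀ {n} (m : ℕ) → Matrix n → Matrix (n + m)
blockDiagJ {n} m M i j with splitAt n i | splitAt n j
... | inj₁ i′ | inj₁ j′ = M i′ j′
... | inj₂ _  | inj₂ _  = 1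
... | _       | _       = 0

-- Let F′_a have F_a as its top-left block and, as its bottom-right kλ₁ × kλ₁ block, the cells
-- holding symbol a in a Latin square of order k (the cyclic one), each cell inflated to a
-- λ₁ × λ₁ block. Every symbol occurs once in each row and column of a Latin square, so these
-- corners have λ₁ ones in every row and column; corners of distinct squares are disjoint, so
-- orthogonality is inherited from the F_a; and together the corners tile J_{kλ₁}.

module Submission where

open import Defs
open import Data.Nat using (ℕ; zero; suc; _+_; _*_; _∸_; _≤_; NonZero)
open import Data.Nat.Properties
  using (+-*-semiring; +-assoc; +-comm; +-suc; +-identityʳ; +-cancelʳ-≡; *-zeroʳ; *-identityʳ;
         *-distribˡ-+; m+[n∸m]≡n; m∸[m∸n]≡n; m∸n≤m; <⇒≤)
open import Data.Nat.DivMod using (_%_; _mod_; %-distribˡ-+; m%n%n≡m%n; [m+n]%n≡m%n; m<n⇒m%n≡m)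
open import Data.Fin as Fin using (Fin; zero; suc; toℕ; splitAt; quotient; _↑ˡ_; _≟_)
open import Data.Fin.Properties using (splitAt-↑ˡ; toℕ-injective; toℕ-fromℕ<; toℕ<n)
open import Data.Fin.Permutation using (Permutation′; permutation; _⟨$⟩ʳ_)
open import Data.Product using (Σ; _×_; _,_; proj₁; proj₂; ∃₂)
open import Data.Sum using (_⊎_; inj₁; inj₂; [_,_]′; map₁)
open import Data.Sum.Properties using ([,]-∘)
open import Data.Empty using (⊥-elim)
open import Function using (_∘_; const; flip)
open import Relation.Nullary using (yes; no)
open import Relation.Binary.PropositionalEquality
open import Algebra.Properties.Semiring.Sum +-*-semiring
  using (sum; sum-cong-≗; sum-replicate-zero; sum-permute)

sumFin≡sum : ∀ {m} (f : Fin m → ℕ) → sumFin f ≡ sum f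
sumFin≡sum {zero}  f = refl
sumFin≡sum {suc m} f = cong (f zero +_) (sumFin≡sum (f ∘ suc))

sum-const : ∀ m c → sum {m} (const c) ≡ m * c
sum-const zero    c = refl
sum-const (suc m) c = cong (c +_) (sum-const m c)

sum-splitAt : ∀ n {m} (h : Fin n ⊎ Fin m → ℕ) →
              sum (h ∘ splitAt n) ≡ sum (h ∘ inj₁) + sum (h ∘ inj₂)
sum-splitAt zero    h = refl
sum-splitAt (suc n) h = trans (cong (h (inj₁ zero) +_) (sum-splitAt n (h ∘ map₁ suc)))
                              (sym (+-assoc (h (inj₁ zero)) _ _))

quotient-suc : ∀ {k} l (x : Fin (suc k * l)) →
               quotient l x ≡ [ const zero , Fin.suc ∘ quotient {k} l ]′ (splitAt l x)
quotient-suc l x with splitAt l x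
... | inj₁ _ = refl
... | inj₂ _ = refl

sum-quotient : ∀ k l (h : Fin k → ℕ) → sum (h ∘ quotient l) ≡ l * sum h
sum-quotient zero    l h = sym (*-zeroʳ l)
sum-quotient (suc k) l h = begin
  sum (h ∘ quotient l)
    ≡⟨ sum-cong-≗ (λ x → trans (cong h (quotient-suc l x)) ([,]-∘ h (splitAt l x))) ⟩
  sum (h′ ∘ splitAt l)
    ≡⟨ sum-splitAt l h′ ⟩
  sum {l} (const (h zero)) + sum (h ∘ Fin.suc ∘ quotient {k} l)
    ≡⟨ cong₂ _+_ (sum-const l (h zero)) (sum-quotient k l (h ∘ Fin.suc)) ⟩
  l * h zero + l * sum (h ∘ Fin.suc)
    ≡⟨ *-distribˡ-+ l (h zero) _ ⟨
  l * sum h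
    ∎
  where
  open ≡-Reasoning
  h′ : Fin l ⊎ Fin (k * l) → ℕ
  h′ = [ const (h zero) , h ∘ Fin.suc ∘ quotient {k} l ]′

IsBit : ℕ → Set
IsBit x = x ≡ 0 ⊎ x ≡ 1

isOne : ℕ → ℕ
isOne 1 = 1
isOne _ = 0

isOne-bit : ∀ {x} → IsBit x → isOne x ≡ x
isOne-bit (inj₁ refl) = refl
isOne-bit (inj₂ refl) = refl

countOnes≡sum∘isOne : ∀ {m} (f : Fin m → ℕ) → countOnes f ≡ sum (isOne ∘ f)
countOnes≡sum∘isOne {zero}  f = refl
countOnes≡sum∘isOne {suc m} f with f zero
... | 0           = countOnes≡sum∘isOne (f ∘ suc)
... | 1           = cong suc (countOnes≡sum∘isOne (f ∘ suc))
... | suc (suc _) = countOnes≡sum∘isOne (f ∘ suc)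

countOnes≡sum : ∀ {m} {f : Fin m → ℕ} → (∀ i → IsBit (f i)) → countOnes f ≡ sum f
countOnes≡sum {f = f} bits = trans (countOnes≡sum∘isOne f) (sum-cong-≗ (isOne-bit ∘ bits))

countOnes-cong : ∀ {m} {f g : Fin m → ℕ} → (∀ i → f i ≡ g i) → countOnes f ≡ countOnes g
countOnes-cong {f = f} {g} f≗g = begin
  countOnes f       ≡⟨ countOnes≡sum∘isOne f ⟩
  sum (isOne ∘ f)   ≡⟨ sum-cong-≗ (cong isOne ∘ f≗g) ⟩
  sum (isOne ∘ g)   ≡⟨ countOnes≡sum∘isOne g ⟨
  countOnes g       ∎
  where open ≡-Reasoning

countOnes-zeros : ∀ m → countOnes {m} (const 0) ≡ 0
countOnes-zeros zero    = refl
countOnes-zeros (suc m) = countOnes-zeros m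

countOnes-splitAt : ∀ n {m} (h : Fin n ⊎ Fin m → ℕ) →
                    countOnes (h ∘ splitAt n) ≡ countOnes (h ∘ inj₁) + countOnes (h ∘ inj₂)
countOnes-splitAt n h = begin
  countOnes (h ∘ splitAt n)                          ≡⟨ countOnes≡sum∘isOne (h ∘ splitAt n) ⟩
  sum (isOne ∘ h ∘ splitAt n)                        ≡⟨ sum-splitAt n (isOne ∘ h) ⟩
  sum (isOne ∘ h ∘ inj₁) + sum (isOne ∘ h ∘ inj₂)    ≡⟨ cong₂ _+_ (countOnes≡sum∘isOne (h ∘ inj₁)) (countOnes≡sum∘isOne (h ∘ inj₂)) ⟨
  countOnes (h ∘ inj₁) + countOnes (h ∘ inj₂)        ∎
  where open ≡-Reasoning

countOnes-quotient : ∀ {k} l (f : Fin k → ℕ) → countOnes (f ∘ quotient l) ≡ l * countOnes f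
countOnes-quotient {k} l f = begin
  countOnes (f ∘ quotient l)      ≡⟨ countOnes≡sum∘isOne (f ∘ quotient l) ⟩
  sum (isOne ∘ f ∘ quotient l)    ≡⟨ sum-quotient k l (isOne ∘ f) ⟩
  l * sum (isOne ∘ f)             ≡⟨ cong (l *_) (countOnes≡sum∘isOne f) ⟨
  l * countOnes f                 ∎
  where open ≡-Reasoning

countOnes-permute : ∀ {k} (f : Fin k → ℕ) (π : Permutation′ k) → countOnes (f ∘ (π ⟨$⟩ʳ_)) ≡ countOnes f
countOnes-permute f π = begin
  countOnes (f ∘ (π ⟨$⟩ʳ_))       ≡⟨ countOnes≡sum∘isOne (f ∘ (π ⟨$⟩ʳ_)) ⟩
  sum (isOne ∘ f ∘ (π ⟨$⟩ʳ_))     ≡⟨ sum-permute (isOne ∘ f) π ⟨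
  sum (isOne ∘ f)                 ≡⟨ countOnes≡sum∘isOne f ⟨
  countOnes f                     ∎
  where open ≡-Reasoning

countZeros+countOnes : ∀ {m} {f : Fin m → ℕ} → (∀ i → IsBit (f i)) → countZeros f + countOnes f ≡ m
countZeros+countOnes {zero}          bits = refl
countZeros+countOnes {suc m} {f} bits with f zero | bits zero
... | .0 | inj₁ refl = cong suc (countZeros+countOnes (bits ∘ suc))
... | .1 | inj₂ refl = trans (+-suc _ _) (cong suc (countZeros+countOnes (bits ∘ suc)))

IsBinary : ∀ {n} → Matrix n → Set
IsBinary M = ∀ i j → IsBit (M i j)

RowOnes : ∀ {n} → ℕ → Matrix n → Set
RowOnes c M = ∀ i → countOnes (M i) ≡ c

Regular : ∀ {n} → ℕ → Matrix n → Set
Regular c M = RowOnes c M × RowOnes c (flip M)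

isBFS⇒regular : ∀ {n λ₀ λ₁ F} → IsBFS n λ₀ λ₁ F → Regular λ₁ F
isBFS⇒regular bfs = row-ones , col-ones
  where open IsBFS bfs

regular⇒isBFS : ∀ {n λ₀ λ₁ F} → λ₀ + λ₁ ≡ n → IsBinary F → Regular λ₁ F → IsBFS n λ₀ λ₁ F
regular⇒isBFS {n} {λ₀} {λ₁} {F} λ₀+λ₁≡n bin (rows , cols) = record
  { type-sum  = λ₀+λ₁≡n
  ; binary    = bin
  ; row-zeros = λ i → zeros (bin i) (rows i)
  ; row-ones  = rows
  ; col-zeros = λ j → zeros (flip bin j) (cols j)
  ; col-ones  = cols
  }
  where
  zeros : {f : Fin n → ℕ} → (∀ i → IsBit (f i)) → countOnes f ≡ λ₁ → countZeros f ≡ λ₀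
  zeros {f} bits ones = +-cancelʳ-≡ λ₁ (countZeros f) λ₀
    (trans (cong (countZeros f +_) (sym ones)) (trans (countZeros+countOnes bits) (sym λ₀+λ₁≡n)))

diagonalBlocks : ∀ {n m} → Matrix n → Matrix m → Fin n ⊎ Fin m → Fin n ⊎ Fin m → ℕ
diagonalBlocks A B (inj₁ i) (inj₁ j) = A i j
diagonalBlocks A B (inj₂ i) (inj₂ j) = B i j
diagonalBlocks A B (inj₁ _) (inj₂ _) = 0
diagonalBlocks A B (inj₂ _) (inj₁ _) = 0

blockDiag : ∀ {n m} → Matrix n → Matrix m → Matrix (n + m)
blockDiag {n} A B i j = diagonalBlocks A B (splitAt n i) (splitAt n j)

module _ {n m} {A : Matrix n} {B : Matrix m} where

  blockDiag-isBinary : IsBinary A → IsBinary B → IsBinary (blockDiag A B)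
  blockDiag-isBinary binA binB i j = blocks-isBit (splitAt n i) (splitAt n j)
    where
    blocks-isBit : ∀ s t → IsBit (diagonalBlocks A B s t)
    blocks-isBit (inj₁ i) (inj₁ j) = binA i j
    blocks-isBit (inj₂ i) (inj₂ j) = binB i j
    blocks-isBit (inj₁ _) (inj₂ _) = inj₁ refl
    blocks-isBit (inj₂ _) (inj₁ _) = inj₁ refl

  blockDiag-↑ˡ : ∀ i j → blockDiag A B (i ↑ˡ m) (j ↑ˡ m) ≡ A i j
  blockDiag-↑ˡ i j = cong₂ (diagonalBlocks A B) (splitAt-↑ˡ n i m) (splitAt-↑ˡ n j m)

  countOnes-blockDiag : ∀ i → countOnes (blockDiag A B i) ≡ [ countOnes ∘ A , countOnes ∘ B ]′ (splitAt n i)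
  countOnes-blockDiag i = trans (countOnes-splitAt n (diagonalBlocks A B (splitAt n i)))
                                (countOnes-blocks (splitAt n i))
    where
    countOnes-blocks : ∀ s → countOnes (diagonalBlocks A B s ∘ inj₁) + countOnes (diagonalBlocks A B s ∘ inj₂)
                             ≡ [ countOnes ∘ A , countOnes ∘ B ]′ s
    countOnes-blocks (inj₁ i) = trans (cong (countOnes (A i) +_) (countOnes-zeros m)) (+-identityʳ _)
    countOnes-blocks (inj₂ i) = cong (_+ countOnes (B i)) (countOnes-zeros n)

  blockDiag-rowOnes : ∀ {c} → RowOnes c A → RowOnes c B → RowOnes c (blockDiag A B)
  blockDiag-rowOnes {c} rowsA rowsB i = trans (countOnes-blockDiag i) (rowOnes-blocks (splitAt n i))
    where
    rowOnes-blocks : ∀ s → [ countOnes ∘ A , countOnes ∘ B ]′ s ≡ c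
    rowOnes-blocks (inj₁ i) = rowsA i
    rowOnes-blocks (inj₂ i) = rowsB i

  flip-blockDiag : ∀ i j → blockDiag A B i j ≡ blockDiag (flip A) (flip B) j i
  flip-blockDiag i j = flip-blocks (splitAt n i) (splitAt n j)
    where
    flip-blocks : ∀ s t → diagonalBlocks A B s t ≡ diagonalBlocks (flip A) (flip B) t s
    flip-blocks (inj₁ _) (inj₁ _) = refl
    flip-blocks (inj₂ _) (inj₂ _) = refl
    flip-blocks (inj₁ _) (inj₂ _) = refl
    flip-blocks (inj₂ _) (inj₁ _) = refl

blockDiag-regular : ∀ {n m c} {A : Matrix n} {B : Matrix m} →
                    Regular c A → Regular c B → Regular c (blockDiag A B)
blockDiag-regular {A = A} {B} (rowsA , colsA) (rowsB , colsB) =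
    blockDiag-rowOnes rowsA rowsB
  , λ j → trans (countOnes-cong (λ i → flip-blockDiag {A = A} {B} i j)) (blockDiag-rowOnes colsA colsB j)

_⊙_ : ∀ {n} → Matrix n → Matrix n → Matrix n
(A ⊙ B) i j = A i j * B i j

bothOnes-blockDiag : ∀ {n m} (A A′ : Matrix n) (B B′ : Matrix m) →
                     bothOnes (blockDiag A B) (blockDiag A′ B′) ≡ bothOnes A A′ + bothOnes B B′
bothOnes-blockDiag {n} A A′ B B′ = begin
  bothOnes (blockDiag A B) (blockDiag A′ B′)
    ≡⟨ sumFin≡sum (countOnes ∘ (blockDiag A B ⊙ blockDiag A′ B′)) ⟩
  sum (countOnes ∘ (blockDiag A B ⊙ blockDiag A′ B′))
    ≡⟨ sum-cong-≗ (λ i → countOnes-cong (λ j → ⊙-blocks (splitAt n i) (splitAt n j))) ⟩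
  sum (countOnes ∘ blockDiag (A ⊙ A′) (B ⊙ B′))
    ≡⟨ sum-cong-≗ (countOnes-blockDiag {A = A ⊙ A′} {B ⊙ B′}) ⟩
  sum ([ countOnes ∘ (A ⊙ A′) , countOnes ∘ (B ⊙ B′) ]′ ∘ splitAt n)
    ≡⟨ sum-splitAt n [ countOnes ∘ (A ⊙ A′) , countOnes ∘ (B ⊙ B′) ]′ ⟩
  sum (countOnes ∘ (A ⊙ A′)) + sum (countOnes ∘ (B ⊙ B′))
    ≡⟨ cong₂ _+_ (sumFin≡sum (countOnes ∘ (A ⊙ A′))) (sumFin≡sum (countOnes ∘ (B ⊙ B′))) ⟨
  bothOnes A A′ + bothOnes B B′
    ∎
  where
  open ≡-Reasoning
  ⊙-blocks : ∀ s t → diagonalBlocks A B s t * diagonalBlocks A′ B′ s t ≡ diagonalBlocks (A ⊙ A′) (B ⊙ B′) s t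
  ⊙-blocks (inj₁ _) (inj₁ _) = refl
  ⊙-blocks (inj₂ _) (inj₂ _) = refl
  ⊙-blocks (inj₁ _) (inj₂ _) = refl
  ⊙-blocks (inj₂ _) (inj₁ _) = refl

bothOnes-disjoint : ∀ {n} (A B : Matrix n) → (∀ i j → A i j * B i j ≡ 0) → bothOnes A B ≡ 0
bothOnes-disjoint {n} A B disjoint = begin
  bothOnes A B                        ≡⟨ sumFin≡sum (countOnes ∘ (A ⊙ B)) ⟩
  sum (countOnes ∘ (A ⊙ B))           ≡⟨ sum-cong-≗ (λ i → trans (countOnes-cong (disjoint i)) (countOnes-zeros n)) ⟩
  sum {n} (const 0)                   ≡⟨ sum-replicate-zero n ⟩
  0                                   ∎
  where open ≡-Reasoning

ZSum-blockDiag : ∀ {k n m} (A : Fin k → Matrix n) (B : Fin k → Matrix m) i j →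
                 ZSum (λ a → blockDiag (A a) (B a)) i j ≡ blockDiag (ZSum A) (ZSum B) i j
ZSum-blockDiag {k} {n} A B i j = sumFin-blocks (splitAt n i) (splitAt n j)
  where
  sumFin-zeros : sumFin {k} (const 0) ≡ 0
  sumFin-zeros = trans (sumFin≡sum {k} (const 0)) (sum-replicate-zero k)
  sumFin-blocks : ∀ s t → sumFin (λ a → diagonalBlocks (A a) (B a) s t) ≡ diagonalBlocks (ZSum A) (ZSum B) s t
  sumFin-blocks (inj₁ _) (inj₁ _) = refl
  sumFin-blocks (inj₂ _) (inj₂ _) = refl
  sumFin-blocks (inj₁ _) (inj₂ _) = sumFin-zeros
  sumFin-blocks (inj₂ _) (inj₁ _) = sumFin-zeros

blockDiag-ones : ∀ {n m} (M : Matrix n) {B : Matrix m} → (∀ x y → B x y ≡ 1) →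
                 ∀ i j → blockDiag M B i j ≡ blockDiagJ m M i j
blockDiag-ones {n} M B≡1 i j with splitAt n i | splitAt n j
... | inj₁ _ | inj₁ _ = refl
... | inj₂ x | inj₂ y = B≡1 x y
... | inj₁ _ | inj₂ _ = refl
... | inj₂ _ | inj₁ _ = refl

inflate : ∀ {k} l → Matrix k → Matrix (k * l)
inflate l M x y = M (quotient l x) (quotient l y)

inflate-rowOnes : ∀ {k c} l {M : Matrix k} → RowOnes c M → RowOnes (l * c) (inflate l M)
inflate-rowOnes l {M} rows x = trans (countOnes-quotient l (M (quotient l x))) (cong (l *_) (rows (quotient l x)))

inflate-isBinary : ∀ {k} l {M : Matrix k} → IsBinary M → IsBinary (inflate l M)
inflate-isBinary l bin x y = bin (quotient l x) (quotient l y)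

inflate-regular : ∀ {k c} l {M : Matrix k} → Regular c M → Regular (l * c) (inflate l M)
inflate-regular l (rows , cols) = inflate-rowOnes l rows , inflate-rowOnes l cols

δ : ∀ {k} → Fin k → Fin k → ℕ
δ zero    zero    = 1
δ zero    (suc _) = 0
δ (suc _) zero    = 0
δ (suc a) (suc b) = δ a b

δ-isBit : ∀ {k} (a b : Fin k) → IsBit (δ a b)
δ-isBit zero    zero    = inj₂ refl
δ-isBit zero    (suc _) = inj₁ refl
δ-isBit (suc _) zero    = inj₁ refl
δ-isBit (suc a) (suc b) = δ-isBit a b

δ-comm : ∀ {k} (a b : Fin k) → δ a b ≡ δ b a
δ-comm zero    zero    = refl
δ-comm zero    (suc _) = refl
δ-comm (suc _) zero    = refl
δ-comm (suc a) (suc b) = δ-comm a b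

δ-≢ : ∀ {k} {a b : Fin k} → a ≢ b → δ a b ≡ 0
δ-≢ {a = zero}  {zero}  a≢b = ⊥-elim (a≢b refl)
δ-≢ {a = zero}  {suc _} a≢b = refl
δ-≢ {a = suc _} {zero}  a≢b = refl
δ-≢ {a = suc _} {suc _} a≢b = δ-≢ (a≢b ∘ cong suc)

δ*δ-≢ : ∀ {k} (c : Fin k) {a b : Fin k} → a ≢ b → δ c a * δ c b ≡ 0
δ*δ-≢ c {a} a≢b with c ≟ a
... | yes refl = trans (cong (δ c c *_) (δ-≢ a≢b)) (*-zeroʳ (δ c c))
... | no  c≢a  = cong (_* _) (δ-≢ c≢a)

sum-δ : ∀ {k} (a : Fin k) → sum (δ a) ≡ 1
sum-δ {suc k} zero    = cong suc (sum-replicate-zero k)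
sum-δ         (suc a) = sum-δ a

countOnes-δ : ∀ {k} (a : Fin k) → countOnes (λ b → δ b a) ≡ 1
countOnes-δ a = begin
  countOnes (λ b → δ b a)   ≡⟨ countOnes-cong (λ b → δ-comm b a) ⟩
  countOnes (δ a)           ≡⟨ countOnes≡sum (δ-isBit a) ⟩
  sum (δ a)                 ≡⟨ sum-δ a ⟩
  1                         ∎
  where open ≡-Reasoning

symbolMatrix : ∀ {k} → (Fin k → Fin k → Fin k) → Fin k → Matrix k
symbolMatrix L a p q = δ (L p q) a

IsLatinSquare : ∀ {k} → (Fin k → Fin k → Fin k) → Set
IsLatinSquare L = ∀ a → Regular 1 (symbolMatrix L a)

symbolMatrix-isBinary : ∀ {k} (L : Fin k → Fin k → Fin k) a → IsBinary (symbolMatrix L a)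
symbolMatrix-isBinary L a p q = δ-isBit (L p q) a

symbolMatrix-disjoint : ∀ {k} (L : Fin k → Fin k → Fin k) {a b} → a ≢ b →
                        ∀ p q → symbolMatrix L a p q * symbolMatrix L b p q ≡ 0
symbolMatrix-disjoint L a≢b p q = δ*δ-≢ (L p q) a≢b

ZSum-symbolMatrix : ∀ {k} (L : Fin k → Fin k → Fin k) p q → ZSum (symbolMatrix L) p q ≡ 1
ZSum-symbolMatrix L p q = trans (sumFin≡sum (δ (L p q))) (sum-δ (L p q))

[[m+n]%o+[o∸n]]%o≡m%o : ∀ m {n} o .{{_ : NonZero o}} → n ≤ o → ((m + n) % o + (o ∸ n)) % o ≡ m % o
[[m+n]%o+[o∸n]]%o≡m%o m {n} o n≤o = begin
  ((m + n) % o + (o ∸ n)) % o          ≡⟨ %-distribˡ-+ ((m + n) % o) (o ∸ n) o ⟩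
  ((m + n) % o % o + (o ∸ n) % o) % o  ≡⟨ cong (λ x → (x + (o ∸ n) % o) % o) (m%n%n≡m%n (m + n) o) ⟩
  ((m + n) % o + (o ∸ n) % o) % o      ≡⟨ %-distribˡ-+ (m + n) (o ∸ n) o ⟨
  (m + n + (o ∸ n)) % o                ≡⟨ cong (_% o) (trans (+-assoc m n (o ∸ n)) (cong (m +_) (m+[n∸m]≡n n≤o))) ⟩
  (m + o) % o                          ≡⟨ [m+n]%n≡m%n m o ⟩
  m % o                                ∎
  where open ≡-Reasoning

module Cyclic (k : ℕ) .{{_ : NonZero k}} where

  infixl 6 _⊕_ _⊖_

  _⊕_ : Fin k → Fin k → Fin k
  p ⊕ q = (toℕ p + toℕ q) mod k

  _⊖_ : Fin k → Fin k → Fin k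
  a ⊖ p = (toℕ a + (k ∸ toℕ p)) mod k

  ⊕-comm : ∀ p q → p ⊕ q ≡ q ⊕ p
  ⊕-comm p q = cong (λ x → x mod k) (+-comm (toℕ p) (toℕ q))

  toℕ-mod : ∀ x → toℕ (x mod k) ≡ x % k
  toℕ-mod x = toℕ-fromℕ< _

  ⊕-⊖-cancel : ∀ p q → q ⊕ p ⊖ p ≡ q
  ⊕-⊖-cancel p q = toℕ-injective (begin
    toℕ (q ⊕ p ⊖ p)                           ≡⟨ toℕ-mod _ ⟩
    (toℕ (q ⊕ p) + (k ∸ toℕ p)) % k           ≡⟨ cong (λ x → (x + (k ∸ toℕ p)) % k) (toℕ-mod _) ⟩
    ((toℕ q + toℕ p) % k + (k ∸ toℕ p)) % k   ≡⟨ [[m+n]%o+[o∸n]]%o≡m%o (toℕ q) k (<⇒≤ (toℕ<n p)) ⟩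
    toℕ q % k                                 ≡⟨ m<n⇒m%n≡m (toℕ<n q) ⟩
    toℕ q                                     ∎)
    where open ≡-Reasoning

  ⊖-⊕-cancel : ∀ p a → a ⊖ p ⊕ p ≡ a
  ⊖-⊕-cancel p a = toℕ-injective (begin
    toℕ (a ⊖ p ⊕ p)                                           ≡⟨ toℕ-mod _ ⟩
    (toℕ (a ⊖ p) + toℕ p) % k                                 ≡⟨ cong (λ x → (x + toℕ p) % k) (toℕ-mod _) ⟩
    ((toℕ a + (k ∸ toℕ p)) % k + toℕ p) % k                   ≡⟨ cong (λ x → ((toℕ a + (k ∸ toℕ p)) % k + x) % k) (m∸[m∸n]≡n p≤k) ⟨
    ((toℕ a + (k ∸ toℕ p)) % k + (k ∸ (k ∸ toℕ p))) % k       ≡⟨ [[m+n]%o+[o∸n]]%o≡m%o (toℕ a) k (m∸n≤m k (toℕ p)) ⟩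
    toℕ a % k                                                 ≡⟨ m<n⇒m%n≡m (toℕ<n a) ⟩
    toℕ a                                                     ∎)
    where
    open ≡-Reasoning
    p≤k = <⇒≤ (toℕ<n p)

  rotation : Fin k → Permutation′ k
  rotation p = permutation (_⊕ p) (_⊖ p) (⊖-⊕-cancel p) (⊕-⊖-cancel p)

  ⊕-isLatinSquare : IsLatinSquare _⊕_
  ⊕-isLatinSquare a = rows , cols
    where
    cols : ∀ q → countOnes (λ p → δ (p ⊕ q) a) ≡ 1
    cols q = trans (countOnes-permute (λ b → δ b a) (rotation q)) (countOnes-δ a)
    rows : ∀ p → countOnes (λ q → δ (p ⊕ q) a) ≡ 1
    rows p = trans (countOnes-cong (λ q → cong (λ x → δ x a) (⊕-comm p q))) (cols p)

latinSquare : ∀ k → Σ (Fin k → Fin k → Fin k) IsLatinSquare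
latinSquare zero    = (λ ()) , (λ ())
latinSquare (suc k) = _⊕_ , ⊕-isLatinSquare
  where open Cyclic (suc k)

-- The Fin k argument rules out k = 0, where k ∸ 1 truncates and the identity fails.
n+[k∸1]*l+l≡n+k*l : ∀ {k} n l → Fin k → n + (k ∸ 1) * l + l ≡ n + k * l
n+[k∸1]*l+l≡n+k*l {suc k} n l _ = trans (+-assoc n (k * l) l) (cong (n +_) (+-comm (k * l) l))

module Construction {k n λ₀ λ₁} (L : Fin k → Fin k → Fin k) (latin : IsLatinSquare L)
                    (F : Fin k → Matrix n) (mofs : IsMOFS k n λ₀ λ₁ F) where

  open IsMOFS mofs

  corner : Fin k → Matrix (k * λ₁)
  corner a = inflate λ₁ (symbolMatrix L a)

  F′ : Fin k → Matrix (n + k * λ₁)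
  F′ a = blockDiag (F a) (corner a)

  corner-isBinary : ∀ a → IsBinary (corner a)
  corner-isBinary a = inflate-isBinary λ₁ (symbolMatrix-isBinary L a)

  corner-disjoint : ∀ {a b} → a ≢ b → ∀ x y → corner a x y * corner b x y ≡ 0
  corner-disjoint a≢b x y = symbolMatrix-disjoint L a≢b (quotient λ₁ x) (quotient λ₁ y)

  corner-regular : ∀ a → Regular λ₁ (corner a)
  corner-regular a = subst (λ c → Regular c (corner a)) (*-identityʳ λ₁) (inflate-regular λ₁ (latin a))

  F′-isBFS : ∀ a → IsBFS (n + k * λ₁) (n + (k ∸ 1) * λ₁) λ₁ (F′ a)
  F′-isBFS a = regular⇒isBFS (n+[k∸1]*l+l≡n+k*l n λ₁ a)
    (blockDiag-isBinary (IsBFS.binary (isBFS a)) (corner-isBinary a))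
    (blockDiag-regular (isBFS⇒regular (isBFS a)) (corner-regular a))

  F′-distinct : ∀ a b → a ≢ b → ∃₂ λ i j → F′ a i j ≢ F′ b i j
  F′-distinct a b a≢b with distinct a b a≢b
  ... | i , j , Fa≢Fb = i ↑ˡ _ , j ↑ˡ _ ,
    λ eq → Fa≢Fb (trans (sym (blockDiag-↑ˡ i j)) (trans eq (blockDiag-↑ˡ i j)))

  F′-orth : ∀ a b → a ≢ b → Orthogonal λ₁ (F′ a) (F′ b)
  F′-orth a b a≢b = begin
    bothOnes (F′ a) (F′ b)
      ≡⟨ bothOnes-blockDiag (F a) (F b) (corner a) (corner b) ⟩
    bothOnes (F a) (F b) + bothOnes (corner a) (corner b)
      ≡⟨ cong₂ _+_ (orth a b a≢b) (bothOnes-disjoint (corner a) (corner b) (corner-disjoint a≢b)) ⟩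
    λ₁ * λ₁ + 0
      ≡⟨ +-identityʳ _ ⟩
    λ₁ * λ₁
      ∎
    where open ≡-Reasoning

  F′-isMOFS : IsMOFS k (n + k * λ₁) (n + (k ∸ 1) * λ₁) λ₁ F′
  F′-isMOFS = record { isBFS = F′-isBFS ; distinct = F′-distinct ; orth = F′-orth }

  ZSum-F′ : ∀ i j → ZSum F′ i j ≡ blockDiagJ (k * λ₁) (ZSum F) i j
  ZSum-F′ i j = trans (ZSum-blockDiag F corner i j)
                      (blockDiag-ones (ZSum F) (λ x y → ZSum-symbolMatrix L _ _) i j)

lemma4p1 : (k n λ₀ λ₁ : ℕ) (F : Fin k → Matrix n) → IsMOFS k n λ₀ λ₁ F →
    Σ (Fin k → Matrix (n + k * λ₁)) (λ F′ →
      IsMOFS k (n + k * λ₁) (n + (k ∸ 1) * λ₁) λ₁ F′ ×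
      (∀ i j → ZSum F′ i j ≡ blockDiagJ (k * λ₁) (ZSum F) i j))
lemma4p1 k n λ₀ λ₁ F mofs = F′ , F′-isMOFS , ZSum-F′
  where open Construction (proj₁ (latinSquare k)) (proj₂ (latinSquare k)) F mofs
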